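{- Let $G$ be a finite connected undirected unweighted graph with node set $V$, let $L,U\subseteq V$ be nonempty and $u\in V$. Then $e(u)-e_L(u)\le d(x,L)$ for every node $x$ with $d(u,x)=e(u)$, and $e^U(u)-e(u)\le 2d(x,U)$ for every node $x$ with $e(u)=d(u,x)+e(x)$.
   Context: $d$ is shortest-path distance, $e(u)=\max_v d(u,v)$, $d(x,S)=\min_{y\in S}d(x,y)$. $e_L(u)=\max_{y\in L}d(u,y)$ and $e^U(u)=\min_{y\in U}(d(u,y)+e(y))$. -}

module Defs where

open import Data.Nat using (ℕ; zero; suc; _≤_; _⊔_; _⊓_)
open import Data.Fin using (Fin)
open import Data.Fin.Subset using (Subset)
open import Data.Vec using (lookup)
open import Data.List using (List; []; _∷_; allFin; map; foldr; filterᵇ)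
open import Data.Empty using (⊥)
open import Relation.Nullary using (¬_)
open import Relation.Binary.PropositionalEquality using (_≡_)

record Graph (n : ℕ) : Set₁ where
  field
    Adj   : Fin n → Fin n → Set
    sym   : ∀ {x y} → Adj x y → Adj y x
    irrefl : ∀ {x} → ¬ Adj x x
open Graph public

data Walk {n : ℕ} (G : Graph n) : Fin n → Fin n → ℕ → Set where
  here : ∀ {x} → Walk G x x zero
  step : ∀ {x y z k} → Adj G x y → Walk G y z k → Walk G x z (suc k)

-- The existence of such a
-- total function d expresses that G is connected.
record IsShortestPathDistance {n : ℕ} (G : Graph n) (d : Fin n → Fin n → ℕ) : Set where
  field
    attained : ∀ x y → Walk G x y (d x y)
    minimal  : ∀ x y k → Walk G x y k → d x y ≤ k

maxL : List ℕ → ℕ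
maxL = foldr _⊔_ 0

-- minimum of a list of naturals (0 for the empty list; only used on nonempty lists)
minL : List ℕ → ℕ
minL []       = 0
minL (a ∷ as) = foldr _⊓_ a as

elems : ∀ {n} → Subset n → List (Fin n)
elems {n} S = filterᵇ (lookup S) (allFin n)

module Dist {n : ℕ} (d : Fin n → Fin n → ℕ) where
  ecc : Fin n → ℕ
  ecc u = maxL (map (d u) (allFin n))

  distTo : Fin n → Subset n → ℕ
  distTo x S = minL (map (d x) (elems S))

  eccL : Subset n → Fin n → ℕ
  eccL L u = maxL (map (d u) (elems L))

  eccU : Subset n → Fin n → ℕ
  eccU U u = minL (map (λ y → d u y Data.Nat.+ ecc y) (elems U))

-- The first bound: some y ∈ L is at distance d(x,L) from x, so e(u) = d(u,x) ≤ d(u,y) + d(y,x)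
-- ≤ e_L(u) + d(x,L).  The second: for y ∈ U at distance d(x,U) from x, the eccentricity is
-- 1-Lipschitz, so e(y) ≤ d(y,x) + e(x), and e^U(u) ≤ d(u,y) + e(y) ≤ d(u,x) + e(x) + 2 d(x,y).
module Submission where

open import Defs
open import Data.Nat using (ℕ; _+_; _∸_; _*_; _≤_; suc; z≤n)
open import Data.Nat.Properties
open import Data.Fin using (Fin)
open import Data.Fin.Subset using (Subset; Nonempty) renaming (_∈_ to _∈ₛ_)
open import Data.Product using (_×_; _,_; ∃-syntax)
open import Data.Sum using (inj₁; inj₂)
open import Data.Bool using (T)
open import Data.List using ([]; _∷_; map; allFin)
open import Data.List.Membership.Propositional using (_∈_)
open import Data.List.Membership.Propositional.Properties
  using (∈-allFin; ∈-filter⁺; ∈-map⁺; ∈-map⁻; foldr-selective)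
open import Data.List.Relation.Unary.Any using (here; there)
open import Data.Vec using (lookup)
open import Data.Vec.Properties using ([]=⇒lookup)
open import Relation.Binary.PropositionalEquality using (_≡_; refl; subst)
import Relation.Binary.PropositionalEquality as ≡
open import Relation.Nullary.Decidable using (T?)

module _ {n : ℕ} {G : Graph n} where

  _∷ʳ_ : ∀ {x y z k} → Walk G x y k → Adj G y z → Walk G x z (suc k)
  here     ∷ʳ a = step a here
  step e w ∷ʳ a = step e (w ∷ʳ a)

  reverse : ∀ {x y k} → Walk G x y k → Walk G y x k
  reverse here       = here
  reverse (step e w) = reverse w ∷ʳ Graph.sym G e

  _++_ : ∀ {x y z k m} → Walk G x y k → Walk G y z m → Walk G x z (k + m)
  here     ++ w = w
  step e v ++ w = step e (v ++ w)

∈⇒≤maxL : ∀ {x xs} → x ∈ xs → x ≤ maxL xs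
∈⇒≤maxL {xs = x ∷ xs} (here refl) = m≤m⊔n x (maxL xs)
∈⇒≤maxL {xs = x ∷ xs} (there p)   = ≤-trans (∈⇒≤maxL p) (m≤n⊔m x (maxL xs))

maxL≤ : ∀ {m} xs → (∀ {x} → x ∈ xs → x ≤ m) → maxL xs ≤ m
maxL≤ []       bound = z≤n
maxL≤ (x ∷ xs) bound = ⊔-lub (bound (here refl)) (maxL≤ xs (λ p → bound (there p)))

∈⇒minL≤ : ∀ {x xs} → x ∈ xs → minL xs ≤ x
∈⇒minL≤ {xs = a ∷ []}     (here refl)         = ≤-refl
∈⇒minL≤ {xs = a ∷ b ∷ bs} (here refl)         = ≤-trans (m⊓n≤n b _) (∈⇒minL≤ {xs = a ∷ bs} (here refl))
∈⇒minL≤ {xs = a ∷ b ∷ bs} (there (here refl)) = m⊓n≤m b _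
∈⇒minL≤ {xs = a ∷ b ∷ bs} (there (there p))   = ≤-trans (m⊓n≤n b _) (∈⇒minL≤ {xs = a ∷ bs} (there p))

minL∈ : ∀ {x xs} → x ∈ xs → minL xs ∈ xs
minL∈ {xs = a ∷ as} _ with foldr-selective ⊓-sel a as
... | inj₁ minL≡a = subst (_∈ a ∷ as) (≡.sym minL≡a) (here refl)
... | inj₂ minL∈as = there minL∈as

minL-map-attained : ∀ {A : Set} (f : A → ℕ) {x xs} → x ∈ xs → ∃[ y ] y ∈ xs × minL (map f xs) ≡ f y
minL-map-attained f x∈xs = ∈-map⁻ f (minL∈ (∈-map⁺ f x∈xs))

∈-elems⁺ : ∀ {n} {S : Subset n} {x} → x ∈ₛ S → x ∈ elems S
∈-elems⁺ {S = S} {x} x∈S =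
  ∈-filter⁺ (λ y → T? (lookup S y)) (∈-allFin x) (subst T (≡.sym ([]=⇒lookup x∈S)) _)

module ShortestPathDistance {n : ℕ} {G : Graph n} {d : Fin n → Fin n → ℕ}
                            (sp : IsShortestPathDistance G d) where

  open IsShortestPathDistance sp
  open Dist d

  d-triangle : ∀ x y z → d x z ≤ d x y + d y z
  d-triangle x y z = minimal x z _ (attained x y ++ attained y z)

  d-sym : ∀ x y → d x y ≡ d y x
  d-sym x y = ≤-antisym (minimal x y _ (reverse (attained y x))) (minimal y x _ (reverse (attained x y)))

  d≤ecc : ∀ x y → d x y ≤ ecc x
  d≤ecc x y = ∈⇒≤maxL (∈-map⁺ (d x) (∈-allFin y))

  ecc-lipschitz : ∀ x y → ecc y ≤ d y x + ecc x
  ecc-lipschitz x y = maxL≤ (map (d y) (allFin n)) bound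
    where
    bound : ∀ {m} → m ∈ map (d y) (allFin n) → m ≤ d y x + ecc x
    bound m∈ with ∈-map⁻ (d y) m∈
    ... | v , _ , refl = ≤-trans (d-triangle y x v) (+-monoʳ-≤ (d y x) (d≤ecc x v))

  distTo-attained : ∀ x {S : Subset n} → Nonempty S → ∃[ y ] y ∈ elems S × distTo x S ≡ d x y
  distTo-attained x (_ , s∈S) = minL-map-attained (d x) (∈-elems⁺ s∈S)

  d≤eccL+distTo : ∀ {L : Subset n} → Nonempty L → ∀ u x → d u x ≤ eccL L u + distTo x L
  d≤eccL+distTo {L} L≢∅ u x with distTo-attained x L≢∅
  ... | y , y∈L , distTo≡ rewrite distTo≡ = begin
    d u x               ≤⟨ d-triangle u y x ⟩
    d u y + d y x       ≡⟨ ≡.cong (d u y +_) (d-sym y x) ⟩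
    d u y + d x y       ≤⟨ +-monoˡ-≤ (d x y) (∈⇒≤maxL (∈-map⁺ (d u) y∈L)) ⟩
    eccL L u + d x y    ∎
    where open ≤-Reasoning

  eccU≤d+ecc+2*distTo : ∀ {U : Subset n} → Nonempty U → ∀ u x → eccU U u ≤ (d u x + ecc x) + 2 * distTo x U
  eccU≤d+ecc+2*distTo {U} U≢∅ u x with distTo-attained x U≢∅
  ... | y , y∈U , distTo≡ rewrite distTo≡ = begin
    eccU U u                          ≤⟨ ∈⇒minL≤ (∈-map⁺ (λ z → d u z + ecc z) y∈U) ⟩
    d u y + ecc y                     ≤⟨ +-mono-≤ (d-triangle u x y) (ecc-lipschitz x y) ⟩
    (d u x + d x y) + (d y x + ecc x) ≡⟨ ≡.cong (λ b → (d u x + d x y) + (b + ecc x)) (d-sym y x) ⟩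
    (d u x + d x y) + (d x y + ecc x) ≡⟨ solve 3 (λ a b c → (a :+ b) :+ (b :+ c) := (a :+ c) :+ con 2 :* b)
                                               refl (d u x) (d x y) (ecc x) ⟩
    (d u x + ecc x) + 2 * d x y       ∎
    where open ≤-Reasoning
          open import Data.Nat.Solver using (module +-*-Solver)
          open +-*-Solver

lemma2 : ∀ {n} (G : Graph n) (d : Fin n → Fin n → ℕ) → IsShortestPathDistance G d →
    (L U : Subset n) → Nonempty L → Nonempty U → (u : Fin n) →
    (∀ x → d u x ≡ Dist.ecc d u → Dist.ecc d u ∸ Dist.eccL d L u ≤ Dist.distTo d x L)
    × (∀ x → Dist.ecc d u ≡ d u x + Dist.ecc d x → Dist.eccU d U u ∸ Dist.ecc d u ≤ 2 * Dist.distTo d x U)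
lemma2 G d sp L U L≢∅ U≢∅ u = eccL-bound , eccU-bound
  where
  open ShortestPathDistance sp
  open Dist d

  eccL-bound : ∀ x → d u x ≡ ecc u → ecc u ∸ eccL L u ≤ distTo x L
  eccL-bound x d≡ecc = m≤n+o⇒m∸n≤o (ecc u) (eccL L u)
    (subst (_≤ eccL L u + distTo x L) d≡ecc (d≤eccL+distTo L≢∅ u x))

  eccU-bound : ∀ x → ecc u ≡ d u x + ecc x → eccU U u ∸ ecc u ≤ 2 * distTo x U
  eccU-bound x ecc≡ = m≤n+o⇒m∸n≤o (eccU U u) (ecc u)
    (subst (λ e → eccU U u ≤ e + 2 * distTo x U) (≡.sym ecc≡) (eccU≤d+ecc+2*distTo U≢∅ u x))
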